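{- Fix $m\ge 2$. For an integer $c\ge1$ let $v_2(c)$ be the largest $v$ with $2^v\mid c$, and let $\mathrm{HW}(c)$ denote the Hamming weight (number of 1-bits in the binary expansion) of $c$. Consider the following two programs. (For-$c$ loop) $G:=[\ ]$; for $c=1$ to $2^{m-1}-1$: let $v=v_2(c)$, let $h=\mathrm{HW}(c)$, set $d:=m-v-h$, and append $[d,d+1,\ldots,d+v]$ to $G$; return $G$. (For-$j$ loop) $G:=[m-1]$; $t:=m-2$; for $j=1$ to $2^{m-2}-1$: let $v=v_2(j)$, append $[t,t+1,t+2,\ldots,t+v+1]\cup[t+v]$ to $G$, then set $t:=t+v-1$; return $G$. Then for each $j$ with $1\le j\le 2^{m-2}-1$, the update of $G$ in iteration $j$ of the for-$j$ loop (i.e. the list $[t,\ldots,t+v+1]\cup[t+v]$ appended there) is equivalent to (equal to the concatenation of) the updates of $G$ in iterations $c=2j$ and $c=2j+1$ of the for-$c$ loop.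
   Context: Here $\cup$ between lists denotes concatenation. Both programs are shown in the paper to produce the same stepping sequence $R_m$ (defined by $R_2=[1]$, $R_m=(R_{m-1}+1)\cup[1,2,\ldots,m-1]\cup R_{m-1}$), and the first element $m-1$ of the for-$j$ loop's initial $G$ corresponds to the iteration $c=1$ of the for-$c$ loop. -}

module Defs where

open import Data.Nat using (ℕ; zero; suc; _≡ᵇ_; _∸_; _^_) renaming (_+_ to _+ℕ_)
open import Data.Nat.DivMod using (_/_; _%_)
open import Data.Integer using (ℤ; +_; _+_; _-_)
open import Data.List using (List; []; _∷_; _++_; map; upTo; concatMap)
open import Data.Bool using (if_then_else_)

-- 2-adic valuation v₂(c) (largest v with 2^v ∣ c), for c ≥ 1.
-- Computed by repeated halving, with fuel c (sufficient since v₂(c) ≤ c).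
-- (Value at c = 0 is irrelevant: only used for c ≥ 1.)
v2-aux : ℕ → ℕ → ℕ
v2-aux zero    n = 0
v2-aux (suc f) n = if n % 2 ≡ᵇ 0 then suc (v2-aux f (n / 2)) else 0

v2 : ℕ → ℕ
v2 c = v2-aux c c

hw-aux : ℕ → ℕ → ℕ
hw-aux zero    n = 0
hw-aux (suc f) n = (n % 2) +ℕ hw-aux f (n / 2)

HW : ℕ → ℕ
HW c = hw-aux c c

range : ℤ → ℕ → List ℤ
range d k = map (λ i → d + + i) (upTo k)

forC-update : ℕ → ℕ → List ℤ
forC-update m c = range (+ m - + v2 c - + HW c) (suc (v2 c))

forC : ℕ → List ℤ
forC m = concatMap (λ i → forC-update m (suc i)) (upTo (2 ^ (m ∸ 1) ∸ 1))

-- For-j loop.  t-before k = value of t before iteration k+1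
-- (t := m-2 initially; after iteration j, t := t + v₂(j) - 1).
t-before : ℕ → ℕ → ℤ
t-before m zero    = + m - + 2
t-before m (suc k) = t-before m k + + v2 (suc k) - + 1

forJ-update : ℕ → ℕ → List ℤ
forJ-update m j = range t (suc (suc v)) ++ (t + + v ∷ [])
  where
    t = t-before m (j ∸ 1)
    v = v2 j

forJ : ℕ → List ℤ
forJ m = (+ m - + 1) ∷ concatMap (λ i → forJ-update m (suc i)) (upTo (2 ^ (m ∸ 2) ∸ 1))

module Submission where

-- Iteration j of the for-j loop appends  [t, …, t+v+1] ∪ [t+v]  with
-- v = v₂(j); iterations 2j and 2j+1 of the for-c loop append
-- [d₂ⱼ, …, d₂ⱼ + v₂(2j)] and [d₂ⱼ₊₁], where d_c = m - v₂(c) - HW(c).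
-- Since v₂(2j) = v₂(j) + 1, v₂(2j+1) = 0, HW(2j) = HW(j) and
-- HW(2j+1) = HW(j) + 1, the lengths agree, and the theorem reduces to the
-- closed form  t = d₂ⱼ  for the pointer t of the for-j loop (then t + v is
-- automatically d₂ⱼ₊₁).  That closed form follows by induction on j from
-- the binary "carry" identity  HW(n+1) + v₂(n+1) = HW(n) + 1.

open import Defs
open import Data.Nat using (ℕ; _≤_; _*_; _+_; _∸_; _^_)
open import Data.List using (_++_)
open import Relation.Binary.PropositionalEquality using (_≡_)

open import Data.Nat using (zero; suc; z≤n; s≤s; s≤s⁻¹; _<_)
open import Data.Nat.Properties using (*-comm; *-suc; +-comm; +-identityʳ; +-suc; ≤-refl; n≤1+n; m≤m+n; ≤-trans; <-≤-trans)
open import Data.Nat.DivMod using (_%_; _/_; m*n%n≡0; m*n/n≡m; [m+kn]%n≡m%n; +-distrib-/-∣ʳ; m/n<m)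
open import Data.Nat.Divisibility using (m∣m*n)
open import Data.Nat.Induction using (<-rec)
open import Data.List using ([]; _∷_)
open import Data.Integer using (ℤ; +_; _-_) renaming (_+_ to _+ℤ_)
open import Data.Integer.Tactic.RingSolver using (solve-∀)
open import Relation.Binary.PropositionalEquality using (refl; sym; trans; cong; cong₂; subst; module ≡-Reasoning)

even-%2 : ∀ q → (2 * q) % 2 ≡ 0
even-%2 q = subst (λ n → n % 2 ≡ 0) (*-comm q 2) (m*n%n≡0 q 2)

even-/2 : ∀ q → (2 * q) / 2 ≡ q
even-/2 q = subst (λ n → n / 2 ≡ q) (*-comm q 2) (m*n/n≡m q 2)

odd-%2 : ∀ q → (1 + 2 * q) % 2 ≡ 1
odd-%2 q = subst (λ n → (1 + n) % 2 ≡ 1) (*-comm q 2) ([m+kn]%n≡m%n 1 q 2)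

odd-/2 : ∀ q → (1 + 2 * q) / 2 ≡ q
odd-/2 q = trans (+-distrib-/-∣ʳ 1 {2 * q} {2} (m∣m*n q)) (even-/2 q)

halve-fuel : ∀ {n f} → n ≤ suc f → n / 2 ≤ f
halve-fuel {zero}  _ = z≤n
halve-fuel {suc n} p = s≤s⁻¹ (<-≤-trans (m/n<m (suc n) 2 (s≤s (s≤s z≤n))) p)

data EvenOdd : ℕ → Set where
  even : ∀ q → EvenOdd (2 * q)
  odd  : ∀ q → EvenOdd (1 + 2 * q)

evenOdd : ∀ n → EvenOdd n
evenOdd zero = even 0
evenOdd (suc n) with evenOdd n
... | even q = odd q
... | odd q  = subst EvenOdd (*-suc 2 q) (even (suc q))

v2-aux-even : ∀ f q → v2-aux (suc f) (2 * q) ≡ suc (v2-aux f q)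
v2-aux-even f q rewrite even-%2 q | even-/2 q = refl

v2-aux-odd : ∀ f q → v2-aux (suc f) (1 + 2 * q) ≡ 0
v2-aux-odd f q rewrite odd-%2 q = refl

hw-aux-even : ∀ f q → hw-aux (suc f) (2 * q) ≡ hw-aux f q
hw-aux-even f q rewrite even-%2 q | even-/2 q = refl

hw-aux-odd : ∀ f q → hw-aux (suc f) (1 + 2 * q) ≡ suc (hw-aux f q)
hw-aux-odd f q rewrite odd-%2 q | odd-/2 q = refl

hw-aux-zero : ∀ f → hw-aux f 0 ≡ 0
hw-aux-zero zero    = refl
hw-aux-zero (suc f) = hw-aux-zero f

hw-aux-fuel : ∀ {f g} n → n ≤ f → n ≤ g → hw-aux f n ≡ hw-aux g n
hw-aux-fuel {zero}  {g}     _ z≤n _   = sym (hw-aux-zero g)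
hw-aux-fuel {suc f} {zero}  _ _   z≤n = hw-aux-zero (suc f)
hw-aux-fuel {suc f} {suc g} n p   r   = cong (λ b → n % 2 + b) (hw-aux-fuel (n / 2) (halve-fuel p) (halve-fuel r))

-- For v₂ the argument must be positive (v2-aux f 0 depends on f).
v2-aux-fuel : ∀ {f g} n → 1 ≤ n → n ≤ f → n ≤ g → v2-aux f n ≡ v2-aux g n
v2-aux-fuel n pos p r with evenOdd n
v2-aux-fuel _ () _ _ | even zero
v2-aux-fuel {suc f} {suc g} _ _ p r | even (suc q) = begin
    v2-aux (suc f) (2 * suc q)  ≡⟨ v2-aux-even f (suc q) ⟩
    suc (v2-aux f (suc q))      ≡⟨ cong suc (v2-aux-fuel (suc q) (s≤s z≤n) (halved p) (halved r)) ⟩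
    suc (v2-aux g (suc q))      ≡⟨ sym (v2-aux-even g (suc q)) ⟩
    v2-aux (suc g) (2 * suc q)  ∎
  where
  open ≡-Reasoning
  halved : ∀ {h} → 2 * suc q ≤ suc h → suc q ≤ h
  halved {h} s = subst (_≤ h) (even-/2 (suc q)) (halve-fuel s)
v2-aux-fuel {suc f} {suc g} _ _ _ _ | odd q = trans (v2-aux-odd f q) (sym (v2-aux-odd g q))

q≤2q : ∀ q → q ≤ 2 * q
q≤2q q = m≤m+n q (q + 0)

v2-double : ∀ j → 1 ≤ j → v2 (2 * j) ≡ suc (v2 j)
v2-double j pos = begin
    v2-aux (2 * j) (2 * j)        ≡⟨ v2-aux-fuel (2 * j) (≤-trans pos (q≤2q j)) ≤-refl (n≤1+n _) ⟩
    v2-aux (suc (2 * j)) (2 * j)  ≡⟨ v2-aux-even (2 * j) j ⟩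
    suc (v2-aux (2 * j) j)        ≡⟨ cong suc (v2-aux-fuel j pos (q≤2q j) ≤-refl) ⟩
    suc (v2 j)                    ∎
  where open ≡-Reasoning

v2-odd : ∀ j → v2 (1 + 2 * j) ≡ 0
v2-odd j = v2-aux-odd (2 * j) j

hw-double : ∀ j → HW (2 * j) ≡ HW j
hw-double j = begin
    hw-aux (2 * j) (2 * j)        ≡⟨ hw-aux-fuel (2 * j) ≤-refl (n≤1+n _) ⟩
    hw-aux (suc (2 * j)) (2 * j)  ≡⟨ hw-aux-even (2 * j) j ⟩
    hw-aux (2 * j) j              ≡⟨ hw-aux-fuel j (q≤2q j) ≤-refl ⟩
    HW j                          ∎
  where open ≡-Reasoning

hw-odd : ∀ j → HW (1 + 2 * j) ≡ suc (HW j)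
hw-odd j = trans (hw-aux-odd (2 * j) j) (cong suc (hw-aux-fuel j (q≤2q j) ≤-refl))

-- Carry identity: adding 1 to n turns its v₂(n+1) trailing 1-bits into 0s
-- and one 0-bit into a 1, so  HW(n+1) + v₂(n+1) = HW(n) + 1.
carry : ∀ n → HW (suc n) + v2 (suc n) ≡ suc (HW n)
carry = <-rec _ step
  where
  step : ∀ n → (∀ {k} → k < n → HW (suc k) + v2 (suc k) ≡ suc (HW k)) →
         HW (suc n) + v2 (suc n) ≡ suc (HW n)
  step n ih with evenOdd n
  ... | even q rewrite hw-odd q | v2-odd q | hw-double q = cong suc (+-identityʳ (HW q))
  ... | odd q = begin
      HW (2 + 2 * q) + v2 (2 + 2 * q)        ≡⟨ cong (λ c → HW c + v2 c) (sym (*-suc 2 q)) ⟩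
      HW (2 * suc q) + v2 (2 * suc q)        ≡⟨ cong₂ _+_ (hw-double (suc q)) (v2-double (suc q) (s≤s z≤n)) ⟩
      HW (suc q) + suc (v2 (suc q))          ≡⟨ +-suc (HW (suc q)) (v2 (suc q)) ⟩
      suc (HW (suc q) + v2 (suc q))          ≡⟨ cong suc (ih (s≤s (q≤2q q))) ⟩
      suc (suc (HW q))                       ≡⟨ cong suc (sym (hw-odd q)) ⟩
      suc (HW (1 + 2 * q))                   ∎
    where open ≡-Reasoning

start : ℕ → ℕ → ℤ
start m c = + m - + v2 c - + HW c

start-double : ∀ m j → 1 ≤ j → start m (2 * j) ≡ + m - + suc (v2 j) - + HW j
start-double m j pos = cong₂ (λ v h → + m - + v - + h) (v2-double j pos) (hw-double j)

start-odd : ∀ m j → start m (1 + 2 * j) ≡ + m - + 0 - + suc (HW j)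
start-odd m j = cong₂ (λ v h → + m - + v - + h) (v2-odd j) (hw-odd j)

t-before-closed : ∀ m k → t-before m k ≡ start m (2 * suc k)
t-before-closed m zero = split-two (+ m)
  where
  split-two : ∀ (M : ℤ) → M - + 2 ≡ M - + 1 - + 1
  split-two = solve-∀
t-before-closed m (suc k) = begin
    t-before m k +ℤ + v k - + 1                        ≡⟨ cong (λ t → t +ℤ + v k - + 1) (t-before-closed m k) ⟩
    start m (2 * suc k) +ℤ + v k - + 1                 ≡⟨ cong (λ d → d +ℤ + v k - + 1) (start-double m (suc k) (s≤s z≤n)) ⟩
    + m - + suc (v k) - + h k +ℤ + v k - + 1           ≡⟨ shift (+ m) (+ v k) (+ h k) ⟩
    + m - + 1 - + suc (h k)                            ≡⟨ cong (λ x → + m - + 1 - + x) (sym (carry (suc k))) ⟩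
    + m - + 1 - + (h (suc k) + v (suc k))              ≡⟨ regroup (+ m) (+ v (suc k)) (+ h (suc k)) ⟩
    + m - + suc (v (suc k)) - + h (suc k)              ≡⟨ sym (start-double m (suc (suc k)) (s≤s z≤n)) ⟩
    start m (2 * suc (suc k))                          ∎
  where
  open ≡-Reasoning
  v h : ℕ → ℕ
  v i = v2 (suc i)
  h i = HW (suc i)
  shift : ∀ (M V H : ℤ) → M - (+ 1 +ℤ V) - H +ℤ V - + 1 ≡ M - + 1 - (+ 1 +ℤ H)
  shift = solve-∀
  regroup : ∀ (M V H : ℤ) → M - + 1 - (H +ℤ V) ≡ M - (+ 1 +ℤ V) - H
  regroup = solve-∀

-- After the first block of iteration j, the pointer t + v₂(j) is the start
-- of for-c iteration 2j+1 (written d + 0 as produced by range d 1).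
t-plus-v2 : ∀ m k → t-before m k +ℤ + v2 (suc k) ≡ start m (1 + 2 * suc k) +ℤ + 0
t-plus-v2 m k = begin
    t-before m k +ℤ + v                        ≡⟨ cong (_+ℤ + v) (t-before-closed m k) ⟩
    start m (2 * suc k) +ℤ + v                 ≡⟨ cong (_+ℤ + v) (start-double m (suc k) (s≤s z≤n)) ⟩
    + m - + suc v - + HW (suc k) +ℤ + v        ≡⟨ cancel (+ m) (+ v) (+ HW (suc k)) ⟩
    + m - + 0 - + suc (HW (suc k)) +ℤ + 0      ≡⟨ cong (_+ℤ + 0) (sym (start-odd m (suc k))) ⟩
    start m (1 + 2 * suc k) +ℤ + 0             ∎
  where
  open ≡-Reasoning
  v : ℕ
  v = v2 (suc k)
  cancel : ∀ (M V H : ℤ) → M - (+ 1 +ℤ V) - H +ℤ V ≡ M - + 0 - (+ 1 +ℤ H) +ℤ + 0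
  cancel = solve-∀

forC-update-double : ∀ m j → 1 ≤ j → forC-update m (2 * j) ≡ range (start m (2 * j)) (suc (suc (v2 j)))
forC-update-double m j pos = cong (λ v → range (start m (2 * j)) (suc v)) (v2-double j pos)

forC-update-odd : ∀ m j → forC-update m (1 + 2 * j) ≡ start m (1 + 2 * j) +ℤ + 0 ∷ []
forC-update-odd m j = cong (λ v → range (start m (1 + 2 * j)) (suc v)) (v2-odd j)

-- Lemma 5.2.  The identity holds for every j ≥ 1; the bounds on m and on j
-- only delimit the range of the loops.
lemma5p2 : (m : ℕ) → 2 ≤ m → (j : ℕ) → 1 ≤ j → j ≤ 2 ^ (m ∸ 2) ∸ 1 →
           forJ-update m j ≡ forC-update m (2 * j) ++ forC-update m (2 * j + 1)
lemma5p2 m _ (suc k) pos _ = begin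
    forJ-update m j
      ≡⟨⟩
    range (t-before m k) (suc (suc v)) ++ (t-before m k +ℤ + v ∷ [])
      ≡⟨ cong₂ (λ d e → range d (suc (suc v)) ++ (e ∷ [])) (t-before-closed m k) (t-plus-v2 m k) ⟩
    range (start m (2 * j)) (suc (suc v)) ++ (start m (1 + 2 * j) +ℤ + 0 ∷ [])
      ≡⟨ cong₂ _++_ (sym (forC-update-double m j pos)) (sym (forC-update-odd m j)) ⟩
    forC-update m (2 * j) ++ forC-update m (1 + 2 * j)
      ≡⟨ cong (λ c → forC-update m (2 * j) ++ forC-update m c) (+-comm 1 (2 * j)) ⟩
    forC-update m (2 * j) ++ forC-update m (2 * j + 1)
      ∎
  where
  open ≡-Reasoning
  j v : ℕ
  j = suc k
  v = v2 j
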